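{- Let $M$ be a set of good oriented edges such that each branch contains the source of at most one edge of $M$, and no branch contains both the source of an edge of $M$ and the destination of an edge of $M$. Then $M$ is valid. If, additionally, every node $v$ incident to an edge of $M$ satisfies $d_M(v)\le q$, and for each bundle at most $q$ edges of $M$ have their source in a branch of that bundle, then $M$ is a $(\gamma-q,\gamma_0+q)$-improvement.
   Context: Let $G=(V,E)$ be a connected graph, $d$ the minimum over spanning trees of $G$ of their maximum degree, and $T$ a spanning tree of $G$; $d_T(v)$ is the degree of $v$ in $T$. Let $h>2d$ and let $\gamma,\gamma_0$ be integers with $\gamma>\gamma_0\ge h$; let $q\ge 1$ be an integer. For an integer $p$, $X_p=\{v\in V: d_T(v)\ge p\}$. Assume $X_\gamma\neq\emptyset$ and root $T$ at an arbitrary node of $X_\gamma$. The connected components of $T$ after deleting the nodes of $X_\gamma$ are called branches; each is a rooted subtree whose root is its node closest to the root of $T$. A branch is a leaf branch if no other branch lies in its subtree (in the rooted $T$). The parent of a branch is the parent in $T$ of its root; for a branch $B$, $e(B)$ is the edge from its root to its parent. A bundle is the set of all branches having the same parent. For a node $u\notin X_\gamma$, $B_u$ is the branch containing $u$. For an oriented edge $e=(u,v)$ of $G$, $u=h(e)$ is its source and $v$ its destination. An oriented edge $(u,v)$ is good if $u$ lies in a leaf branch, $v$ lies in a branch different from $B_u$, and $d_T(u)<\gamma_0$, $d_T(v)<\gamma_0$. A set $M$ of oriented edges is valid if $T_M=(T\setminus M')\cup M$ is an (undirected) tree, where $M'=\{e(B_{h(e)}): e\in M\}$. A parent $v$ of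 a leaf branch $B$ is improved if $B=B_{h(e)}$ for some $e\in M$. A valid $M$ is an $(x,y)$-improvement if (a) every improved parent $v$ has $d_{T_M}(v)\ge x$, and (b) every node $v$ with $d_{T_M}(v)>d_T(v)$ has $d_{T_M}(v)\le y$. $d_M(v)$ is the number of edges of $M$ incident to $v$. -}

module Defs where

open import Data.Nat using (ℕ; zero; suc; _+_; _*_; _∸_; _≤_; _<_; _⊔_)
open import Data.Fin using (Fin; _≟_)
open import Data.Bool using (Bool; true; false; if_then_else_; _∨_)
open import Data.List using (List; []; _∷_; _++_; length; map; foldr; allFin)
open import Data.Nat.ListAction using (sum)
open import Data.List.Relation.Unary.All using (All)
open import Data.List.Relation.Unary.Unique.Propositional using (Unique)
open import Data.List.Relation.Unary.Linked using (Linked)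
open import Data.List.Membership.Propositional using (_∈_)
open import Data.Product using (Σ; _×_; _,_; proj₁; proj₂)
open import Data.Sum using (_⊎_)
open import Relation.Binary.PropositionalEquality using (_≡_; _≢_)
open import Relation.Nullary using (¬_)
open import Relation.Nullary.Decidable using (isYes)

Graph : ℕ → Set
Graph n = Fin n → Fin n → Bool

Rel : ℕ → Set₁
Rel n = Fin n → Fin n → Set

Edge : ∀ {n} → Graph n → Rel n
Edge G x y = G x y ≡ true

SimpleGraph : ∀ {n} → Graph n → Set
SimpleGraph {n} G = (∀ (x y : Fin n) → G x y ≡ G y x) × (∀ (x : Fin n) → G x x ≡ false)

data Walk {n} (R : Rel n) : Fin n → Fin n → Set where
  stop : ∀ {x} → Walk R x x
  step : ∀ {x y z} → R x y → Walk R y z → Walk R x z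

verts : ∀ {n} {R : Rel n} {x y : Fin n} → Walk R x y → List (Fin n)
verts {x = x} stop = x ∷ []
verts {x = x} (step _ p) = x ∷ verts p

wlen : ∀ {n} {R : Rel n} {x y : Fin n} → Walk R x y → ℕ
wlen stop = 0
wlen (step _ p) = suc (wlen p)

Connected : ∀ {n} → Rel n → Set
Connected {n} R = ∀ (x y : Fin n) → Walk R x y

-- a cycle x, v1, ..., vm, y (m ≥ 1, so at least 3 distinct vertices)
-- with the closing edge y – x
HasCycle : ∀ {n} → Rel n → Set
HasCycle {n} R =
  Σ (Fin n) λ x → Σ (Fin n) λ y → Σ (List (Fin n)) λ vs →
    (1 ≤ length vs) × Unique (x ∷ vs ++ y ∷ []) × Linked R (x ∷ vs ++ y ∷ []) × R y x

IsTree : ∀ {n} → Rel n → Set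
IsTree {n} R =
  (∀ (x y : Fin n) → R x y → R y x) × (∀ (x : Fin n) → ¬ R x x) × Connected R × ¬ HasCycle R

deg : ∀ {n} → Graph n → Fin n → ℕ
deg {n} G v = sum (map (λ w → if G v w then 1 else 0) (allFin n))

maxDeg : ∀ {n} → Graph n → ℕ
maxDeg {n} G = foldr _⊔_ 0 (map (deg G) (allFin n))

SpanningTree : ∀ {n} → Graph n → Graph n → Set
SpanningTree {n} G T = (∀ (x y : Fin n) → T x y ≡ true → G x y ≡ true) × IsTree (Edge T)

MinMaxDeg : ∀ {n} → Graph n → ℕ → Set
MinMaxDeg {n} G d =
  (Σ (Graph n) λ T → SpanningTree G T × maxDeg T ≡ d) ×
  (∀ (T : Graph n) → SpanningTree G T → d ≤ maxDeg T)

-- degree bounds for a Set-valued relation: "deg_R v ≥ k" and "deg_R v ≤ k"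
DegGe : ∀ {n} → Rel n → Fin n → ℕ → Set
DegGe {n} R v k = Σ (List (Fin n)) λ ws → Unique ws × All (R v) ws × k ≤ length ws

DegLe : ∀ {n} → Rel n → Fin n → ℕ → Set
DegLe {n} R v k = ∀ (ws : List (Fin n)) → Unique ws → All (R v) ws → length ws ≤ k

-- Notions relative to the spanning tree T rooted at r and the threshold γ
-- (X_γ = { v | γ ≤ d_T(v) }).

InSubtree : ∀ {n} → Graph n → Fin n → Fin n → Fin n → Set
InSubtree T r w x = ∀ (p : Walk (Edge T) x r) → w ∈ verts p

IsParent : ∀ {n} → Graph n → Fin n → Fin n → Fin n → Set
IsParent T r p x = Edge T p x × x ≢ r × InSubtree T r p x

-- u and v lie in the same branch (connected component of T − X_γ)
SameBranch : ∀ {n} → ℕ → Graph n → Fin n → Fin n → Set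
SameBranch γ T u v =
  deg T u < γ × deg T v < γ ×
  Σ (Walk (Edge T) u v) λ p → All (λ z → deg T z < γ) (verts p)

IsBranchRoot : ∀ {n} → ℕ → Graph n → Fin n → Fin n → Fin n → Set
IsBranchRoot {n} γ T r u w =
  SameBranch γ T u w ×
  (∀ (x : Fin n) → SameBranch γ T u x → (px : Walk (Edge T) x r) →
     Σ (Walk (Edge T) w r) λ pw → wlen pw ≤ wlen px)

BranchParent : ∀ {n} → ℕ → Graph n → Fin n → Fin n → Fin n → Set
BranchParent {n} γ T r u p = Σ (Fin n) λ w → IsBranchRoot γ T r u w × IsParent T r p w

InBranchSubtree : ∀ {n} → ℕ → Graph n → Fin n → Fin n → Fin n → Set
InBranchSubtree {n} γ T r u z = Σ (Fin n) λ x → SameBranch γ T u x × InSubtree T r x z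

LeafBranch : ∀ {n} → ℕ → Graph n → Fin n → Fin n → Set
LeafBranch {n} γ T r u =
  deg T u < γ ×
  (∀ (y : Fin n) → deg T y < γ → ¬ SameBranch γ T u y →
     ¬ (∀ (z : Fin n) → SameBranch γ T y z → InBranchSubtree γ T r u z))

OEdge : ℕ → Set
OEdge n = Fin n × Fin n

src : ∀ {n} → OEdge n → Fin n
src = proj₁

dst : ∀ {n} → OEdge n → Fin n
dst = proj₂

Good : ∀ {n} → Graph n → ℕ → ℕ → Graph n → Fin n → OEdge n → Set
Good G γ γ₀ T r e =
  Edge G (src e) (dst e) ×
  LeafBranch γ T r (src e) ×
  deg T (dst e) < γ × ¬ SameBranch γ T (src e) (dst e) ×
  deg T (src e) < γ₀ × deg T (dst e) < γ₀

Removed : ∀ {n} → ℕ → Graph n → Fin n → List (OEdge n) → Rel n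
Removed {n} γ T r M x y =
  Σ (OEdge n) λ e → e ∈ M × Σ (Fin n) λ w → Σ (Fin n) λ p →
    IsBranchRoot γ T r (src e) w × IsParent T r p w ×
    ((x ≡ w × y ≡ p) ⊎ (x ≡ p × y ≡ w))

TM : ∀ {n} → ℕ → Graph n → Fin n → List (OEdge n) → Rel n
TM γ T r M x y = (Edge T x y × ¬ Removed γ T r M x y) ⊎ ((x , y) ∈ M ⊎ (y , x) ∈ M)

Valid : ∀ {n} → ℕ → Graph n → Fin n → List (OEdge n) → Set
Valid γ T r M = IsTree (TM γ T r M)

Improved : ∀ {n} → ℕ → Graph n → Fin n → List (OEdge n) → Fin n → Set
Improved {n} γ T r M v =
  Σ (OEdge n) λ e → e ∈ M × LeafBranch γ T r (src e) × BranchParent γ T r (src e) v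

Improvement : ∀ {n} → ℕ → Graph n → Fin n → List (OEdge n) → ℕ → ℕ → Set
Improvement {n} γ T r M x y =
  Valid γ T r M ×
  (∀ (v : Fin n) → Improved γ T r M v → DegGe (TM γ T r M) v x) ×
  (∀ (v : Fin n) → DegGe (TM γ T r M) v (suc (deg T v)) → DegLe (TM γ T r M) v y)

dM : ∀ {n} → List (OEdge n) → Fin n → ℕ
dM M v = sum (map (λ e → if isYes (src e ≟ v) ∨ isYes (dst e ≟ v) then 1 else 0) M)

{-# OPTIONS --safe #-}
-- Removing e(B_{h(e)}) detaches the subtree of the leaf branch B_{h(e)}, and e reattaches it.
-- T_M is connected: climbing from any node to the root meets at most one removed edge e(B_{h(e)}),
-- where we cross B_{h(e)} to h(e) and take e; from its destination the climb meets no removed edge,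
-- since that would put the destination inside a leaf branch containing a source.  T_M is acyclic:
-- a cycle through an edge (u, z) of M must re-enter the subtree of B_u, but the only tree edge
-- entering it, e(B_u), is removed, and no other edge of M has an endpoint there.  Degrees: only
-- endpoints of M (T-degree < γ₀) gain edges, at most d_M(v) ≤ q of them, and an improved parent loses
-- one edge per branch of its bundle holding a source, at most q.
module Submission where

open import Defs
open import Data.Bool as Bool using (Bool; true; false; if_then_else_)
open import Data.Empty using (⊥; ⊥-elim)
open import Data.Fin using (Fin; _≟_)
open import Data.Fin.Properties using (any?)
open import Data.List using (List; []; _∷_; _++_; length; map; filter; allFin)
open import Data.List.Membership.Propositional using (_∈_; _∉_; find; lose)
open import Data.List.Membership.Propositional.Properties using (∈-allFin; ∈-filter⁺; ∈-filter⁻; ∈-++⁺ˡ; ∈-++⁺ʳ)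
open import Data.List.Properties using (length-++; length-tabulate)
open import Data.List.Relation.Binary.Subset.Propositional using (_⊆_)
open import Data.List.Relation.Unary.All as All using (All; []; _∷_)
open import Data.List.Relation.Unary.All.Properties using (All¬⇒¬Any; ¬Any⇒All¬)
open import Data.List.Relation.Unary.AllPairs using ([]; _∷_)
open import Data.List.Relation.Unary.Any as Any using (Any; here; there; _─_)
open import Data.List.Relation.Unary.Linked using (Linked; [-]; _∷_)
open import Data.List.Relation.Unary.Unique.Propositional using (Unique)
import Data.List.Relation.Unary.Unique.Propositional.Properties as Unique
open import Data.Nat using (ℕ; zero; suc; _+_; _*_; _∸_; _≤_; _<_; z≤n; s≤s)
open import Data.Nat.ListAction using (sum)
open import Data.Nat.Properties
  using (≤-refl; ≤-trans; n≤1+n; <⇒≤; <⇒≱; ≮⇒≥; _<?_; _≤?_; +-identityʳ; +-mono-≤; +-monoʳ-≤; m≤n+o⇒m∸n≤o; n≮0; ≤-pred; <-≤-trans; +-suc; +-comm; suc-injective; module ≤-Reasoning)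
open import Data.Product using (Σ; _×_; _,_; proj₁; proj₂)
open import Data.Sum using (_⊎_; inj₁; inj₂; [_,_]′)
open import Data.Unit using (⊤; tt)
open import Function using (_∘_)
open import Relation.Binary.PropositionalEquality
  using (_≡_; _≢_; refl; sym; cong; cong₂; subst; setoid; module ≡-Reasoning)
open import Relation.Nullary using (¬_; Dec; yes; no; _×-dec_; _⊎-dec_; ¬?)
open import Relation.Unary using (Decidable)

module _ {A : Set} where

  length-─ : ∀ {x} {ys : List A} (p : x ∈ ys) → length ys ≡ suc (length (ys ─ p))
  length-─ (here _)  = refl
  length-─ (there p) = cong suc (length-─ p)

  ∈-─ : ∀ {x t} {ys : List A} (p : x ∈ ys) → t ∈ ys → t ≢ x → t ∈ (ys ─ p)
  ∈-─ (here refl) (here refl) t≢x = ⊥-elim (t≢x refl)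
  ∈-─ (here _)    (there i)   _   = i
  ∈-─ (there p)   (here refl) _   = here refl
  ∈-─ (there p)   (there i)   t≢x = there (∈-─ p i t≢x)

  Unique∧⊆⇒length≤ : ∀ {xs ys : List A} → Unique xs → xs ⊆ ys → length xs ≤ length ys
  Unique∧⊆⇒length≤ {[]}     _            _     = z≤n
  Unique∧⊆⇒length≤ {x ∷ xs} {ys} (x∉xs ∷ u) xs⊆ys = begin
    suc (length xs)          ≤⟨ s≤s (Unique∧⊆⇒length≤ u xs−x⊆ys−x) ⟩
    suc (length (ys ─ x∈ys)) ≡⟨ sym (length-─ x∈ys) ⟩
    length ys                ∎
    where
    open ≤-Reasoning
    x∈ys = xs⊆ys (here refl)
    xs−x⊆ys−x : xs ⊆ (ys ─ x∈ys)
    xs−x⊆ys−x i = ∈-─ x∈ys (xs⊆ys (there i)) λ { refl → All.lookup x∉xs i refl }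

  count≡length-filter : ∀ (f : A → Bool) xs →
    sum (map (λ w → if f w then 1 else 0) xs) ≡ length (filter (λ w → f w Bool.≟ true) xs)
  count≡length-filter f [] = refl
  count≡length-filter f (x ∷ xs) with f x
  ... | true  = cong suc (count≡length-filter f xs)
  ... | false = count≡length-filter f xs

module Walks {n : ℕ} (R : Rel n) where
  open import Data.List.Relation.Binary.Permutation.Setoid.Properties (setoid (Fin n)) as ↭
    using (Unique-resp-↭)

  infixr 5 _++ʷ_
  _++ʷ_ : ∀ {x y z} → Walk R x y → Walk R y z → Walk R x z
  stop     ++ʷ q = q
  step e p ++ʷ q = step e (p ++ʷ q)

  start∈verts : ∀ {x y} (p : Walk R x y) → x ∈ verts p
  start∈verts stop       = here refl
  start∈verts (step _ _) = here refl

  end∈verts : ∀ {x y} (p : Walk R x y) → y ∈ verts p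
  end∈verts stop       = here refl
  end∈verts (step _ p) = there (end∈verts p)

  length-verts : ∀ {x y} (p : Walk R x y) → length (verts p) ≡ suc (wlen p)
  length-verts stop       = refl
  length-verts (step _ p) = cong suc (length-verts p)

  verts-++ʷ-step : ∀ {x y y′ z} (p : Walk R x y) (e : R y y′) (q : Walk R y′ z) →
                   verts (p ++ʷ step e q) ≡ verts p ++ verts q
  verts-++ʷ-step stop       e q = refl
  verts-++ʷ-step (step _ p) e q = cong (_ ∷_) (verts-++ʷ-step p e q)

  wlen-++ʷ-step : ∀ {x y y′ z} (p : Walk R x y) (e : R y y′) (q : Walk R y′ z) →
                  wlen (p ++ʷ step e q) ≡ wlen p + suc (wlen q)
  wlen-++ʷ-step stop       e q = refl
  wlen-++ʷ-step (step _ p) e q = cong suc (wlen-++ʷ-step p e q)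

  ∈-++ʷ⁻ : ∀ {x y z t} (p : Walk R x y) (q : Walk R y z) →
           t ∈ verts (p ++ʷ q) → t ∈ verts p ⊎ t ∈ verts q
  ∈-++ʷ⁻ stop       q i         = inj₂ i
  ∈-++ʷ⁻ (step _ p) q (here e)  = inj₁ (here e)
  ∈-++ʷ⁻ (step _ p) q (there i) with ∈-++ʷ⁻ p q i
  ... | inj₁ j = inj₁ (there j)
  ... | inj₂ j = inj₂ j

  All-++ʷ : ∀ {P : Fin n → Set} {x y z} (p : Walk R x y) (q : Walk R y z) →
            All P (verts p) → All P (verts q) → All P (verts (p ++ʷ q))
  All-++ʷ p q Ap Aq = All.tabulate λ i → [ All.lookup Ap , All.lookup Aq ]′ (∈-++ʷ⁻ p q i)

  AllSteps : (Fin n → Fin n → Set) → ∀ {x y} → Walk R x y → Set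
  AllSteps Q stop                = ⊤
  AllSteps Q (step {x} {y} _ p) = Q x y × AllSteps Q p

  AllSteps-++ʷ : ∀ {Q x y z} (p : Walk R x y) (q : Walk R y z) →
                 AllSteps Q p → AllSteps Q q → AllSteps Q (p ++ʷ q)
  AllSteps-++ʷ stop       q _        Qq = Qq
  AllSteps-++ʷ (step _ p) q (a , Qp) Qq = a , AllSteps-++ʷ p q Qp Qq

  AvoidsStep : Fin n → Fin n → ∀ {x y} → Walk R x y → Set
  AvoidsStep a b = AllSteps λ s t → ¬ (s ≡ a × t ≡ b)

  avoidsStep-∉source : ∀ {a b x y} (p : Walk R x y) → a ∉ verts p → AvoidsStep a b p
  avoidsStep-∉source stop       _   = tt
  avoidsStep-∉source (step _ p) a∉ =
    (λ { (refl , _) → a∉ (here refl) }) , avoidsStep-∉source p (λ i → a∉ (there i))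

  avoidsStep-∉target : ∀ {a b x y} (p : Walk R x y) → b ∉ verts p → AvoidsStep a b p
  avoidsStep-∉target stop       _   = tt
  avoidsStep-∉target (step _ p) b∉ =
    (λ { (_ , refl) → b∉ (there (start∈verts p)) }) , avoidsStep-∉target p (λ i → b∉ (there i))

  -- On a path, the first vertex is left only once and the last one entered only once.
  path-avoidsStep : ∀ {x y} (p : Walk R x y) → Unique (verts p) → 2 ≤ wlen p → AvoidsStep x y p
  path-avoidsStep (step e stop) _ (s≤s ())
  path-avoidsStep (step e (step e′ p)) (x∉ ∷ y₁∉ ∷ _) _ =
    (λ { (_ , refl) → All.lookup y₁∉ (end∈verts p) refl }) ,
    avoidsStep-∉source (step e′ p) (All¬⇒¬Any x∉)

  crossing : ∀ {Q} {P : Fin n → Set} → Decidable P → ∀ {a b} (p : Walk R a b) →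
             ¬ P a → P b → AllSteps Q p →
             Σ (Fin n) λ s → Σ (Fin n) λ t → R s t × ¬ P s × P t × Q s t
  crossing P? stop ¬Pa Pb _ = ⊥-elim (¬Pa Pb)
  crossing P? (step {y = t} e p) ¬Pa Pb (q , Qp) with P? t
  ... | yes Pt = _ , t , e , ¬Pa , Pt , q
  ... | no ¬Pt = crossing P? p ¬Pt Pb Qp

  prefix : ∀ {x y t} (p : Walk R x y) → t ∈ verts p → Walk R x t
  prefix stop       (here refl) = stop
  prefix (step e p) (here refl) = stop
  prefix (step e p) (there i)   = step e (prefix p i)

  prefix-⊆ : ∀ {x y t} (p : Walk R x y) (i : t ∈ verts p) → verts (prefix p i) ⊆ verts p
  prefix-⊆ stop       (here refl) j         = j
  prefix-⊆ (step e p) (here refl) (here eq) = here eq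
  prefix-⊆ (step e p) (there i)   (here eq) = here eq
  prefix-⊆ (step e p) (there i)   (there j) = there (prefix-⊆ p i j)

  suffix : ∀ {x y t} (p : Walk R x y) → t ∈ verts p → Walk R t y
  suffix stop       (here refl) = stop
  suffix (step e p) (here refl) = step e p
  suffix (step e p) (there i)   = suffix p i

  suffix-AllSteps : ∀ {Q x y t} (p : Walk R x y) (i : t ∈ verts p) →
                    AllSteps Q p → AllSteps Q (suffix p i)
  suffix-AllSteps stop       (here refl) _         = tt
  suffix-AllSteps (step e p) (here refl) Qp        = Qp
  suffix-AllSteps (step e p) (there i)   (_ , Qp) = suffix-AllSteps p i Qp

  suffix-Unique : ∀ {x y t} (p : Walk R x y) (i : t ∈ verts p) →
                  Unique (verts p) → Unique (verts (suffix p i))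
  suffix-Unique stop       (here refl) u       = u
  suffix-Unique (step e p) (here refl) u       = u
  suffix-Unique (step e p) (there i)   (_ ∷ u) = suffix-Unique p i u

  suffix-⊆ : ∀ {x y t} (p : Walk R x y) (i : t ∈ verts p) → verts (suffix p i) ⊆ verts p
  suffix-⊆ stop       (here refl) j = j
  suffix-⊆ (step e p) (here refl) j = j
  suffix-⊆ (step e p) (there i)   j = there (suffix-⊆ p i j)

  wlen-suffix≤ : ∀ {x y t} (p : Walk R x y) (i : t ∈ verts p) → wlen (suffix p i) ≤ wlen p
  wlen-suffix≤ stop       (here refl) = z≤n
  wlen-suffix≤ (step e p) (here refl) = ≤-refl
  wlen-suffix≤ (step e p) (there i)   = ≤-trans (wlen-suffix≤ p i) (n≤1+n _)

  wlen-suffix< : ∀ {x y t} (p : Walk R x y) (i : t ∈ verts p) → t ≢ x → wlen (suffix p i) < wlen p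
  wlen-suffix< stop       (here refl) t≢x = ⊥-elim (t≢x refl)
  wlen-suffix< (step e p) (here refl) t≢x = ⊥-elim (t≢x refl)
  wlen-suffix< (step e p) (there i)   _   = s≤s (wlen-suffix≤ p i)

  no-infinite-descent : ∀ {x y} → (∀ (p : Walk R x y) → Σ (Walk R x y) λ q → wlen q < wlen p) →
                        ¬ Walk R x y
  no-infinite-descent {x} {y} shorten p = descend (wlen p) p ≤-refl
    where
    descend : ∀ k (p : Walk R x y) → wlen p ≤ k → ⊥
    descend k p p≤k with shorten p
    descend zero    p p≤k | q , q<p = n≮0 (<-≤-trans q<p p≤k)
    descend (suc k) p p≤k | q , q<p = descend k q (≤-pred (<-≤-trans q<p p≤k))

  toPath : ∀ {x y} → Walk R x y → Walk R x y
  toPath stop = stop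
  toPath (step {x} e p) with Any.any? (x ≟_) (verts (toPath p))
  ... | yes i = suffix (toPath p) i
  ... | no _  = step e (toPath p)

  toPath-Unique : ∀ {x y} (p : Walk R x y) → Unique (verts (toPath p))
  toPath-Unique stop = [] ∷ []
  toPath-Unique (step {x} e p) with Any.any? (x ≟_) (verts (toPath p))
  ... | yes i  = suffix-Unique (toPath p) i (toPath-Unique p)
  ... | no x∉ = ¬Any⇒All¬ _ x∉ ∷ toPath-Unique p

  toPath-AllSteps : ∀ {Q x y} (p : Walk R x y) → AllSteps Q p → AllSteps Q (toPath p)
  toPath-AllSteps stop _ = tt
  toPath-AllSteps (step {x} e p) (q , Qp) with Any.any? (x ≟_) (verts (toPath p))
  ... | yes i = suffix-AllSteps (toPath p) i (toPath-AllSteps p Qp)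
  ... | no _  = q , toPath-AllSteps p Qp

  wlen-toPath< : ∀ {x y} (p : Walk R x y) → wlen (toPath p) < n
  wlen-toPath< p = begin-strict
    wlen (toPath p)                  <⟨ ≤-refl ⟩
    suc (wlen (toPath p))            ≡⟨ sym (length-verts (toPath p)) ⟩
    length (verts (toPath p))        ≤⟨ Unique∧⊆⇒length≤ (toPath-Unique p) (λ {t} _ → ∈-allFin t) ⟩
    length (allFin n)                ≡⟨ length-tabulate (λ i → i) ⟩
    n                                ∎
    where open ≤-Reasoning

  module _ (R? : ∀ x y → Dec (R x y)) where

    boundedWalk? : ∀ k x y → Dec (Σ (Walk R x y) λ p → wlen p ≤ k)
    boundedWalk? k x y with x ≟ y
    ... | yes refl = yes (stop , z≤n)
    boundedWalk? zero x y | no x≢y =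
      no λ { (stop , _) → x≢y refl ; (step _ _ , ()) }
    boundedWalk? (suc k) x y | no x≢y with any? (λ z → R? x z ×-dec boundedWalk? k z y)
    ... | yes (z , e , p , p≤k) = yes (step e p , s≤s p≤k)
    ... | no ∄z = no λ { (stop , _) → x≢y refl ; (step e p , s≤s p≤k) → ∄z (_ , e , p , p≤k) }

    walk? : ∀ x y → Dec (Walk R x y)
    walk? x y with boundedWalk? n x y
    ... | yes (p , _) = yes p
    ... | no ∄p       = no λ p → ∄p (toPath p , <⇒≤ (wlen-toPath< p))

  module _ (R-sym : ∀ {x y} → R x y → R y x) where

    reverse : ∀ {x y} → Walk R x y → Walk R y x
    reverse stop       = stop
    reverse (step e p) = reverse p ++ʷ step (R-sym e) stop

    ∈-reverse⁻ : ∀ {x y t} (p : Walk R x y) → t ∈ verts (reverse p) → t ∈ verts p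
    ∈-reverse⁻ stop       i = i
    ∈-reverse⁻ (step e p) i with ∈-++ʷ⁻ (reverse p) (step (R-sym e) stop) i
    ... | inj₁ j                   = there (∈-reverse⁻ p j)
    ... | inj₂ (here refl)         = there (start∈verts p)
    ... | inj₂ (there (here refl)) = here refl

    avoidsStep-reverse : ∀ {a b x y} (p : Walk R x y) → AvoidsStep a b p → AvoidsStep b a (reverse p)
    avoidsStep-reverse stop       _        = tt
    avoidsStep-reverse (step e p) (q , Ap) =
      AllSteps-++ʷ (reverse p) _ (avoidsStep-reverse p Ap) ((λ (s≡b , t≡a) → q (t≡a , s≡b)) , tt)

  verts-Linked : ∀ {x y} (p : Walk R x y) → Linked R (verts p)
  verts-Linked stop                 = [-]
  verts-Linked (step e stop)        = e ∷ [-]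
  verts-Linked (step e (step e′ p)) = e ∷ verts-Linked (step e′ p)

  Linked⇒walk : ∀ x zs y → Linked R (x ∷ zs ++ y ∷ []) →
                Σ (Walk R x y) λ p → verts p ≡ x ∷ zs ++ y ∷ []
  Linked⇒walk x []       y (e ∷ [-]) = step e stop , refl
  Linked⇒walk x (z ∷ zs) y (e ∷ l) with Linked⇒walk z zs y l
  ... | p , eq = step e p , cong (x ∷_) eq

  verts-init : ∀ {x y} (p : Walk R x y) → Σ (List (Fin n)) λ vs → verts p ≡ vs ++ y ∷ []
  verts-init stop = [] , refl
  verts-init {x} (step e p) with verts-init p
  ... | vs , eq = x ∷ vs , cong (x ∷_) eq

  ClosesCycle : Fin n → Fin n → Set
  ClosesCycle a b = R a b × Σ (Walk R b a) λ p → Unique (verts p) × 2 ≤ wlen p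

  wlen≡length-init : ∀ {x y vs} (p : Walk R x y) → verts p ≡ vs ++ y ∷ [] → wlen p ≡ length vs
  wlen≡length-init {y = y} {vs} p eq = suc-injective (begin
    suc (wlen p)           ≡⟨ sym (length-verts p) ⟩
    length (verts p)       ≡⟨ cong length eq ⟩
    length (vs ++ y ∷ [])  ≡⟨ length-++ vs ⟩
    length vs + 1          ≡⟨ +-comm (length vs) 1 ⟩
    suc (length vs)        ∎)
    where open ≡-Reasoning

  closesCycle⇒hasCycle : ∀ {a b} → ClosesCycle a b → HasCycle R
  closesCycle⇒hasCycle (_ , step _ stop , _ , s≤s ())
  closesCycle⇒hasCycle {a} {b} (e , step e′ p@(step _ _) , u , _) with verts-init p
  ... | vs , eq = b , a , vs , subst (1 ≤_) (wlen≡length-init p eq) (s≤s z≤n) ,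
                  subst Unique (cong (b ∷_) eq) u ,
                  subst (Linked R) (cong (b ∷_) eq) (verts-Linked (step e′ p)) , e

  hasCycle⇒closesCycle : HasCycle R → Σ (Fin n) λ a → Σ (Fin n) λ b → ClosesCycle a b
  hasCycle⇒closesCycle (x , y , vs , 1≤vs , u , l , e) with Linked⇒walk x vs y l
  ... | p , eq = y , x , e , p , subst Unique (sym eq) u ,
                 subst (2 ≤_) (sym (wlen≡length-init p eq)) (s≤s 1≤vs)

  closesCycle-rotate : ∀ {a b c d} → R a b → (p : Walk R b c) (e : R c d) (q : Walk R d a) →
                       Unique (verts (p ++ʷ step e q)) → 2 ≤ wlen (p ++ʷ step e q) → ClosesCycle c d
  closesCycle-rotate ab p e q u 2≤ =
    e , q ++ʷ step ab p ,
    subst Unique (sym (verts-++ʷ-step q ab p))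
      (Unique-resp-↭ (↭.++-comm (verts p) (verts q)) (subst Unique (verts-++ʷ-step p e q) u)) ,
    subst (2 ≤_) wlen≡ 2≤
    where
    open ≡-Reasoning
    wlen≡ : wlen (p ++ʷ step e q) ≡ wlen (q ++ʷ step ab p)
    wlen≡ = begin
      wlen (p ++ʷ step e q)    ≡⟨ wlen-++ʷ-step p e q ⟩
      wlen p + suc (wlen q)    ≡⟨ +-suc (wlen p) (wlen q) ⟩
      suc (wlen p + wlen q)    ≡⟨ cong suc (+-comm (wlen p) (wlen q)) ⟩
      suc (wlen q + wlen p)    ≡⟨ sym (+-suc (wlen q) (wlen p)) ⟩
      wlen q + suc (wlen p)    ≡⟨ sym (wlen-++ʷ-step q ab p) ⟩
      wlen (q ++ʷ step ab p)   ∎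

module WalksWithin {n : ℕ} (R : Rel n) (P : Fin n → Set) where
  open Walks R

  Within : Rel n
  Within x y = R x y × P x × P y

  WalkWithin : Fin n → Fin n → Set
  WalkWithin x y = Σ (Walk R x y) λ p → All P (verts p)

  private
    fromWithin : ∀ {x y} → P x → Walk Within x y → WalkWithin x y
    fromWithin Px stop                  = stop , Px ∷ []
    fromWithin Px (step (e , _ , Py) q) with fromWithin Py q
    ... | p , Ap = step e p , Px ∷ Ap

    toWithin : ∀ {x y} (p : Walk R x y) → All P (verts p) → Walk Within x y
    toWithin stop       _         = stop
    toWithin (step e p) (Px ∷ Ap) = step (e , Px , All.lookup Ap (start∈verts p)) (toWithin p Ap)

  walkWithin? : (∀ x y → Dec (R x y)) → Decidable P → ∀ x y → Dec (WalkWithin x y)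
  walkWithin? R? P? x y with P? x
  ... | no ¬Px = no λ (p , Ap) → ¬Px (All.lookup Ap (start∈verts p))
  ... | yes Px with Walks.walk? Within (λ s t → R? s t ×-dec (P? s ×-dec P? t)) x y
  ...   | yes q = yes (fromWithin Px q)
  ...   | no ¬q = no λ (p , Ap) → ¬q (toWithin p Ap)

module Tree {n : ℕ} (T : Graph n) (tree : IsTree (Edge T)) (r : Fin n) where

  E : Rel n
  E = Edge T

  open Walks E public

  E-sym : ∀ {x y} → E x y → E y x
  E-sym {x} {y} = proj₁ tree x y

  E-irrefl : ∀ {x} → ¬ E x x
  E-irrefl {x} = proj₁ (proj₂ tree) x

  E-connected : Connected E
  E-connected = proj₁ (proj₂ (proj₂ tree))

  E-acyclic : ¬ HasCycle E
  E-acyclic = proj₂ (proj₂ (proj₂ tree))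

  E? : ∀ x y → Dec (E x y)
  E? x y = T x y Bool.≟ true

  E⇒≢ : ∀ {x y} → E x y → x ≢ y
  E⇒≢ e refl = E-irrefl e

  rev : ∀ {x y} → Walk E x y → Walk E y x
  rev = reverse E-sym

  edge-bridge : ∀ {a b} → E a b → (p : Walk E a b) → ¬ AvoidsStep a b p
  edge-bridge {a} {b} ab p avoids = onPath (toPath p) (toPath-Unique p) (toPath-AllSteps p avoids)
    where
    onPath : (p : Walk E a b) → Unique (verts p) → ¬ AvoidsStep a b p
    onPath stop                 _ _       = E-irrefl ab
    onPath (step _ stop)        _ (q , _) = q (refl , refl)
    onPath p@(step _ (step _ _)) u _      =
      E-acyclic (closesCycle⇒hasCycle (E-sym ab , p , u , s≤s (s≤s z≤n)))

  siblings-joined⇒≡ : ∀ {v y y′} → E v y → E v y′ → (p : Walk E y′ y) → v ∉ verts p → y ≡ y′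
  siblings-joined⇒≡ {v} {y} {y′} vy vy′ p v∉p with y ≟ y′
  ... | yes y≡y′ = y≡y′
  ... | no y≢y′  = ⊥-elim (edge-bridge vy (step vy′ p)
                     ((λ (_ , y′≡y) → y≢y′ (sym y′≡y)) , avoidsStep-∉source p v∉p))

  AvoidingWalk : Fin n → Fin n → Set
  AvoidingWalk w x = Σ (Walk E x r) λ p → w ∉ verts p

  avoidingWalk? : ∀ w x → Dec (AvoidingWalk w x)
  avoidingWalk? w x with WalksWithin.walkWithin? E (w ≢_) E? (λ z → ¬? (w ≟ z)) x r
  ... | yes (p , w≢p) = yes (p , All¬⇒¬Any w≢p)
  ... | no ∄p         = no λ (p , w∉p) → ∄p (p , ¬Any⇒All¬ _ w∉p)

  ¬avoidingWalk⇒inSubtree : ∀ {w x} → ¬ AvoidingWalk w x → InSubtree T r w x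
  ¬avoidingWalk⇒inSubtree {w} ∄p p with Any.any? (w ≟_) (verts p)
  ... | yes w∈p = w∈p
  ... | no w∉p  = ⊥-elim (∄p (p , w∉p))

  inSubtree? : ∀ w x → Dec (InSubtree T r w x)
  inSubtree? w x with avoidingWalk? w x
  ... | yes (p , w∉p) = no λ w≽x → w∉p (w≽x p)
  ... | no ∄p         = yes (¬avoidingWalk⇒inSubtree ∄p)

  ¬inSubtree⇒avoidingWalk : ∀ {w x} → ¬ InSubtree T r w x → AvoidingWalk w x
  ¬inSubtree⇒avoidingWalk {w} {x} w⋡x with avoidingWalk? w x
  ... | yes p = p
  ... | no ∄p = ⊥-elim (w⋡x (¬avoidingWalk⇒inSubtree ∄p))

  isParent? : ∀ p x → Dec (IsParent T r p x)
  isParent? p x = E? p x ×-dec (¬? (x ≟ r) ×-dec inSubtree? p x)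

  inSubtree-refl : ∀ {w} → InSubtree T r w w
  inSubtree-refl = start∈verts

  inSubtree-trans : ∀ {u v w} → InSubtree T r u v → InSubtree T r v w → InSubtree T r u w
  inSubtree-trans u≽v v≽w p = suffix-⊆ p (v≽w p) (u≽v (suffix p (v≽w p)))

  inSubtree-extend : ∀ {w t s} → InSubtree T r w t → (p : Walk E t s) → w ∉ verts p → InSubtree T r w s
  inSubtree-extend w≽t p w∉p q with ∈-++ʷ⁻ p q (w≽t (p ++ʷ q))
  ... | inj₁ w∈p = ⊥-elim (w∉p w∈p)
  ... | inj₂ w∈q = w∈q

  path-step-isParent : ∀ {c d} → E c d → (p : Walk E d r) → c ∉ verts p → IsParent T r d c
  path-step-isParent {c} {d} cd p c∉p = E-sym cd , (λ { refl → c∉p (end∈verts p) }) , d≽c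
    where
    d≽c : InSubtree T r d c
    d≽c q with Any.any? (d ≟_) (verts q)
    ... | yes d∈q = d∈q
    ... | no d∉q  = ⊥-elim (edge-bridge cd (q ++ʷ rev p)
                      (AllSteps-++ʷ q (rev p) (avoidsStep-∉target q d∉q)
                        (avoidsStep-∉source (rev p) (λ i → c∉p (∈-reverse⁻ E-sym p i)))))

  inSubtree-of-child : ∀ {v y x} → IsParent T r v y → (p : Walk E y x) → v ∉ verts p → InSubtree T r y x
  inSubtree-of-child {v} {y} (vy , _ , v≽y) p v∉p q with Any.any? (y ≟_) (verts q)
  ... | yes y∈q = y∈q
  ... | no y∉q with ∈-++ʷ⁻ p q (v≽y (p ++ʷ q))
  ...   | inj₁ v∈p = ⊥-elim (v∉p v∈p)
  ...   | inj₂ v∈q = ⊥-elim (edge-bridge (E-sym vy) (p ++ʷ prefix q v∈q)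
                       (AllSteps-++ʷ p _ (avoidsStep-∉target p v∉p)
                         (avoidsStep-∉source (prefix q v∈q) (λ i → y∉q (prefix-⊆ q v∈q i)))))

  edge-entering-subtree : ∀ {w p s t} → IsParent T r p w → InSubtree T r w t → ¬ InSubtree T r w s →
                          E s t → s ≡ p × t ≡ w
  edge-entering-subtree {w} {p} {s} {t} (pw , _ , p≽w) w≽t w⋡s st
    with ¬inSubtree⇒avoidingWalk w⋡s
  ... | q , w∉q with w≽t (step (E-sym st) q)
  ...   | there w∈q = ⊥-elim (w∉q w∈q)
  ...   | here refl with s ≟ p
  ...     | yes s≡p = s≡p , refl
  ...     | no s≢p with p≽w (step (E-sym st) q)
  ...       | here p≡w   = ⊥-elim (E⇒≢ pw p≡w)
  ...       | there p∈q = ⊥-elim (edge-bridge (E-sym pw) (step (E-sym st) (prefix q p∈q))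
                            ((λ (_ , s≡p) → s≢p s≡p) ,
                             avoidsStep-∉source (prefix q p∈q) (λ i → w∉q (prefix-⊆ q p∈q i))))

module Branches {n : ℕ} (T : Graph n) (tree : IsTree (Edge T)) (r : Fin n)
                (γ : ℕ) (r-heavy : γ ≤ deg T r) where

  open Tree T tree r public

  Heavy Light : Fin n → Set
  Heavy z = γ ≤ deg T z
  Light z = deg T z < γ

  light⇒¬heavy : ∀ {z} → Light z → ¬ Heavy z
  light⇒¬heavy = <⇒≱

  infix 4 _∼_
  _∼_ : Fin n → Fin n → Set
  _∼_ = SameBranch γ T

  ∼-light₂ : ∀ {u v} → u ∼ v → Light v
  ∼-light₂ = proj₁ ∘ proj₂

  branchWalk : ∀ {u v} → u ∼ v → Walk E u v
  branchWalk = proj₁ ∘ proj₂ ∘ proj₂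

  branchWalk-light : ∀ {u v} (s : u ∼ v) → All Light (verts (branchWalk s))
  branchWalk-light = proj₂ ∘ proj₂ ∘ proj₂

  heavy∉branchWalk : ∀ {u v x} (s : u ∼ v) → Heavy x → x ∉ verts (branchWalk s)
  heavy∉branchWalk s hx i = light⇒¬heavy (All.lookup (branchWalk-light s) i) hx

  ∼-refl : ∀ {u} → Light u → u ∼ u
  ∼-refl lu = lu , lu , stop , lu ∷ []

  ∼-sym : ∀ {u v} → u ∼ v → v ∼ u
  ∼-sym (lu , lv , p , Ap) = lv , lu , rev p , All.tabulate λ i → All.lookup Ap (∈-reverse⁻ E-sym p i)

  ∼-trans : ∀ {u v w} → u ∼ v → v ∼ w → u ∼ w
  ∼-trans (lu , _ , p , Ap) (_ , lw , q , Aq) = lu , lw , p ++ʷ q , All-++ʷ p q Ap Aq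

  ∼-step : ∀ {u v w} → u ∼ v → E v w → Light w → u ∼ w
  ∼-step s vw lw = ∼-trans s (∼-light₂ s , lw , step vw stop , ∼-light₂ s ∷ lw ∷ [])

  ∼-∈branchWalk : ∀ {u v x} (s : u ∼ v) → x ∈ verts (branchWalk s) → u ∼ x
  ∼-∈branchWalk (lu , _ , p , Ap) i =
    lu , All.lookup Ap i , prefix p i , All.tabulate λ j → All.lookup Ap (prefix-⊆ p i j)

  _∼?_ : ∀ u v → Dec (u ∼ v)
  u ∼? v = (deg T u <? γ) ×-dec ((deg T v <? γ) ×-dec
           WalksWithin.walkWithin? E Light E? (λ z → deg T z <? γ) u v)

  siblings-in-branch⇒≡ : ∀ {v y y′} → E v y → E v y′ → Heavy v → y ∼ y′ → y ≡ y′
  siblings-in-branch⇒≡ vy vy′ hv s =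
    siblings-joined⇒≡ vy vy′ (branchWalk (∼-sym s)) (heavy∉branchWalk (∼-sym s) hv)

  -- If p were light it would lie in B_u, and would be strictly closer to r than the root w.
  branchParent-heavy : ∀ {u w p} → IsBranchRoot γ T r u w → IsParent T r p w → Heavy p
  branchParent-heavy {u} {w} {p} (u∼w , closest) (pw , _ , p≽w) with deg T p <? γ
  ... | no ¬lp = ≮⇒≥ ¬lp
  ... | yes lp = ⊥-elim (no-infinite-descent shorten (E-connected p r))
    where
    shorten : ∀ (q : Walk E p r) → Σ (Walk E p r) λ q′ → wlen q′ < wlen q
    shorten q with closest p (∼-step u∼w (E-sym pw) lp) q
    ... | q′ , q′≤q = suffix q′ (p≽w q′) , <-≤-trans (wlen-suffix< q′ (p≽w q′) (E⇒≢ pw)) q′≤q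

  isBranchRoot-of-heavyParent : ∀ {u y v} → u ∼ y → IsParent T r v y → Heavy v → IsBranchRoot γ T r u y
  isBranchRoot-of-heavyParent u∼y par hv = u∼y , λ x u∼x q →
    let y∼x = ∼-trans (∼-sym u∼y) u∼x
        y∈q = inSubtree-of-child par (branchWalk y∼x) (heavy∉branchWalk y∼x hv) q
    in suffix q y∈q , wlen-suffix≤ q y∈q

  branchRoot-inSubtree : ∀ {u w p} → IsBranchRoot γ T r u w → IsParent T r p w → InSubtree T r w u
  branchRoot-inSubtree root@(u∼w , _) par =
    inSubtree-of-child par (branchWalk (∼-sym u∼w)) (heavy∉branchWalk (∼-sym u∼w) (branchParent-heavy root par))

  branchParent-exists : ∀ {u} → Light u → Σ (Fin n) (BranchParent γ T r u)
  branchParent-exists {u} lu = climb (∼-refl lu) (toPath (E-connected u r)) (toPath-Unique (E-connected u r))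
    where
    climb : ∀ {c} → u ∼ c → (p : Walk E c r) → Unique (verts p) → Σ (Fin n) (BranchParent γ T r u)
    climb u∼r stop _ = ⊥-elim (light⇒¬heavy (∼-light₂ u∼r) r-heavy)
    climb {c} u∼c (step {y = d} cd p) (c∉p ∷ u) with deg T d <? γ
    ... | yes ld = climb (∼-step u∼c cd ld) p u
    ... | no ¬ld = d , c , isBranchRoot-of-heavyParent u∼c par (≮⇒≥ ¬ld) , par
      where par = path-step-isParent cd p (All¬⇒¬Any c∉p)

  leafBranch-subtree : ∀ {u w t} → LeafBranch γ T r u → IsBranchRoot γ T r u w →
                       InSubtree T r w t → Light t → u ∼ t
  leafBranch-subtree {u} {w} {t} (_ , leaf) (u∼w , _) w≽t lt with u ∼? t
  ... | yes u∼t = u∼t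
  ... | no u≁t  = ⊥-elim (leaf t lt u≁t λ z t∼z →
          w , u∼w , inSubtree-extend w≽t (branchWalk t∼z)
                      (λ i → u≁t (∼-trans u∼w (∼-sym (∼-∈branchWalk t∼z i)))))

module Neighbours {n : ℕ} (T : Graph n) where

  neighbours : Fin n → List (Fin n)
  neighbours v = filter (λ w → T v w Bool.≟ true) (allFin n)

  deg≡length-neighbours : ∀ v → deg T v ≡ length (neighbours v)
  deg≡length-neighbours v = count≡length-filter (T v) (allFin n)

  ∈-neighbours⁺ : ∀ {v w} → Edge T v w → w ∈ neighbours v
  ∈-neighbours⁺ {v} {w} vw = ∈-filter⁺ (λ w → T v w Bool.≟ true) (∈-allFin w) vw

  ∈-neighbours⁻ : ∀ {v w} → w ∈ neighbours v → Edge T v w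
  ∈-neighbours⁻ {v} i = proj₂ (∈-filter⁻ (λ w → T v w Bool.≟ true) {xs = allFin n} i)

  neighbours-Unique : ∀ v → Unique (neighbours v)
  neighbours-Unique v = Unique.filter⁺ (λ w → T v w Bool.≟ true) (Unique.allFin⁺ n)

module _ {n : ℕ} where

  -- The other endpoints of the edges of es at v, counted with multiplicity as in dM.
  mNeighbours : Fin n → List (OEdge n) → List (Fin n)
  mNeighbours v [] = []
  mNeighbours v (e ∷ es) with src e ≟ v | dst e ≟ v
  ... | yes _ | _     = dst e ∷ mNeighbours v es
  ... | no _  | yes _ = src e ∷ mNeighbours v es
  ... | no _  | no _  = mNeighbours v es

  length-mNeighbours : ∀ v es → length (mNeighbours v es) ≡ dM es v
  length-mNeighbours v [] = refl
  length-mNeighbours v (e ∷ es) with src e ≟ v | dst e ≟ v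
  ... | yes _ | _     = cong suc (length-mNeighbours v es)
  ... | no _  | yes _ = cong suc (length-mNeighbours v es)
  ... | no _  | no _  = length-mNeighbours v es

  ∈-mNeighbours-src : ∀ {v w es} → (v , w) ∈ es → w ∈ mNeighbours v es
  ∈-mNeighbours-src {v} {w} {e ∷ es} (here refl) with v ≟ v
  ... | yes _  = here refl
  ... | no v≢v = ⊥-elim (v≢v refl)
  ∈-mNeighbours-src {v} {w} {e ∷ es} (there i) with src e ≟ v | dst e ≟ v
  ... | yes _ | _     = there (∈-mNeighbours-src i)
  ... | no _  | yes _ = there (∈-mNeighbours-src i)
  ... | no _  | no _  = ∈-mNeighbours-src i

  ∈-mNeighbours-dst : ∀ {v w es} → (w , v) ∈ es → w ∈ mNeighbours v es
  ∈-mNeighbours-dst {v} {w} {e ∷ es} (here refl) with w ≟ v | v ≟ v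
  ... | yes w≡v | _      = here w≡v
  ... | no _    | yes _  = here refl
  ... | no _    | no v≢v = ⊥-elim (v≢v refl)
  ∈-mNeighbours-dst {v} {w} {e ∷ es} (there i) with src e ≟ v | dst e ≟ v
  ... | yes _ | _     = there (∈-mNeighbours-dst i)
  ... | no _  | yes _ = there (∈-mNeighbours-dst i)
  ... | no _  | no _  = ∈-mNeighbours-dst i

  incident-of-dM≢0 : ∀ {v es k} → dM es v ≡ suc k → Σ (OEdge n) λ e → e ∈ es × (v ≡ src e ⊎ v ≡ dst e)
  incident-of-dM≢0 {v} {e ∷ es} eq with src e ≟ v | dst e ≟ v
  ... | yes s≡v | _       = e , here refl , inj₁ (sym s≡v)
  ... | no _    | yes d≡v = e , here refl , inj₂ (sym d≡v)
  ... | no _    | no _ with incident-of-dM≢0 eq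
  ...   | e′ , i , inc = e′ , there i , inc

module Exchange {n : ℕ} (T : Graph n) (tree : IsTree (Edge T)) (r : Fin n)
                (γ : ℕ) (r-heavy : γ ≤ deg T r) (M : List (OEdge n))
                (src-leaf : ∀ {e} → e ∈ M → LeafBranch γ T r (src e))
                (dst-light : ∀ {e} → e ∈ M → deg T (dst e) < γ)
                (src-unique : ∀ e e′ → e ∈ M → e′ ∈ M → SameBranch γ T (src e) (src e′) → e ≡ e′)
                (src≁dst : ∀ e e′ → e ∈ M → e′ ∈ M → ¬ SameBranch γ T (src e) (dst e′)) where

  open Branches T tree r γ r-heavy

  src-light : ∀ {e} → e ∈ M → Light (src e)
  src-light = proj₁ ∘ src-leaf

  Eᴹ : Rel n
  Eᴹ = TM γ T r M

  MEdge : Fin n → Fin n → Set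
  MEdge a b = (a , b) ∈ M ⊎ (b , a) ∈ M

  -- Then x is the root of B_{src e} and x–y is the edge e(B_{src e}).
  Cut : OEdge n → Fin n → Fin n → Set
  Cut e x y = src e ∼ x × IsParent T r y x × Heavy y

  Cuts : Fin n → Fin n → Set
  Cuts x y = Any (λ e → Cut e x y ⊎ Cut e y x) M

  cuts? : ∀ x y → Dec (Cuts x y)
  cuts? x y = Any.any? (λ e → cut? e x y ⊎-dec cut? e y x) M
    where
    cut? : ∀ e x y → Dec (Cut e x y)
    cut? e x y = (src e ∼? x) ×-dec (isParent? y x ×-dec (γ ≤? deg T y))

  removed⇒cuts : ∀ {x y} → Removed γ T r M x y → Cuts x y
  removed⇒cuts (e , e∈M , w , p , root , par , inj₁ (refl , refl)) =
    lose e∈M (inj₁ (proj₁ root , par , branchParent-heavy root par))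
  removed⇒cuts (e , e∈M , w , p , root , par , inj₂ (refl , refl)) =
    lose e∈M (inj₂ (proj₁ root , par , branchParent-heavy root par))

  kept : ∀ {x y} → E x y → ¬ Cuts x y → Eᴹ x y
  kept xy ¬cut = inj₁ (xy , ¬cut ∘ removed⇒cuts)

  light-¬cuts : ∀ {x y} → Light x → Light y → ¬ Cuts x y
  light-¬cuts lx ly cut with find cut
  ... | _ , _ , inj₁ (_ , _ , hy) = light⇒¬heavy ly hy
  ... | _ , _ , inj₂ (_ , _ , hx) = light⇒¬heavy lx hx

  Eᴹ-sym : ∀ {x y} → Eᴹ x y → Eᴹ y x
  Eᴹ-sym (inj₁ (xy , ¬rem)) = inj₁ (E-sym xy , ¬rem ∘ flip)
    where
    flip : ∀ {x y} → Removed γ T r M y x → Removed γ T r M x y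
    flip (e , e∈M , w , p , root , par , inj₁ (a , b)) = e , e∈M , w , p , root , par , inj₂ (b , a)
    flip (e , e∈M , w , p , root , par , inj₂ (a , b)) = e , e∈M , w , p , root , par , inj₁ (b , a)
  Eᴹ-sym (inj₂ (inj₁ m)) = inj₂ (inj₂ m)
  Eᴹ-sym (inj₂ (inj₂ m)) = inj₂ (inj₁ m)

  Eᴹ-irrefl : ∀ x → ¬ Eᴹ x x
  Eᴹ-irrefl x (inj₁ (xx , _))  = E-irrefl xx
  Eᴹ-irrefl x (inj₂ (inj₁ m)) = src≁dst _ _ m m (∼-refl (src-light m))
  Eᴹ-irrefl x (inj₂ (inj₂ m)) = src≁dst _ _ m m (∼-refl (src-light m))

  module Wᴹ = Walks Eᴹ

  branchWalkᴹ : ∀ {u v} (p : Walk E u v) → All Light (verts p) → Walk Eᴹ u v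
  branchWalkᴹ stop       _         = stop
  branchWalkᴹ (step e p) (lx ∷ Ap) =
    step (kept e (light-¬cuts lx (All.lookup Ap (start∈verts p)))) (branchWalkᴹ p Ap)

  -- A path to the root goes up, so a removed edge on it is e(B) entered from B itself.
  pathStep-cut : ∀ {c d} → (p : Walk E d r) → c ∉ verts p → Cuts c d →
                 Σ (OEdge n) λ e → e ∈ M × Cut e c d
  pathStep-cut p c∉p cut with find cut
  ... | e , e∈M , inj₁ c-cut                    = e , e∈M , c-cut
  ... | _ , _   , inj₂ (_ , (_ , _ , c≽d) , _) = ⊥-elim (c∉p (c≽d p))

  -- Every removed edge met above dst e would make dst e part of a leaf branch B_{src e′}.
  dst-reaches-root : ∀ {e} → e ∈ M → Walk Eᴹ (dst e) r
  dst-reaches-root {e} e∈M =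
    climb inSubtree-refl (toPath (E-connected (dst e) r)) (toPath-Unique (E-connected (dst e) r))
    where
    climb : ∀ {c} → InSubtree T r c (dst e) → (p : Walk E c r) → Unique (verts p) → Walk Eᴹ c r
    climb _ stop _ = stop
    climb {c} c≽z (step {y = d} cd p) (c∉p ∷ u) with cuts? c d
    ... | no ¬cut = step (kept cd ¬cut) (climb (inSubtree-trans d≽c c≽z) p u)
      where
      d≽c : InSubtree T r d c
      d≽c = proj₂ (proj₂ (path-step-isParent cd p (All¬⇒¬Any c∉p)))
    ... | yes cut with pathStep-cut p (All¬⇒¬Any c∉p) cut
    ...   | e′ , e′∈M , (s , par , hd) =
            ⊥-elim (src≁dst e′ e e′∈M e∈M (leafBranch-subtree (src-leaf e′∈M)
                      (isBranchRoot-of-heavyParent s par hd) c≽z (dst-light e∈M)))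

  reaches-root : ∀ x → Walk Eᴹ x r
  reaches-root x = ascend (toPath (E-connected x r)) (toPath-Unique (E-connected x r))
    where
    ascend : ∀ {c} → (p : Walk E c r) → Unique (verts p) → Walk Eᴹ c r
    ascend stop _ = stop
    ascend {c} (step {y = d} cd p) (c∉p ∷ u) with cuts? c d
    ... | no ¬cut = step (kept cd ¬cut) (ascend p u)
    ... | yes cut with pathStep-cut p (All¬⇒¬Any c∉p) cut
    ...   | e , e∈M , (s , _ , _) =
            branchWalkᴹ (branchWalk (∼-sym s)) (branchWalk-light (∼-sym s))
              Wᴹ.++ʷ step (inj₂ (inj₁ e∈M)) (dst-reaches-root e∈M)

  Eᴹ-connected : Connected Eᴹ
  Eᴹ-connected x y = reaches-root x Wᴹ.++ʷ Wᴹ.reverse Eᴹ-sym (reaches-root y)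

  -- The path must enter the subtree of the root w of B_u; the only tree edge doing so is the
  -- removed e(B_u), and an edge of M doing so would have an endpoint in the leaf branch B_u.
  M-edge-bridge : ∀ {u z} → (u , z) ∈ M → (p : Walk Eᴹ z u) → ¬ Wᴹ.AvoidsStep z u p
  M-edge-bridge {u} {z} m p avoids with branchParent-exists (src-light m)
  ... | v , w , root , par
    with Wᴹ.crossing (inSubtree? w) p w⋡z (branchRoot-inSubtree root par) avoids
    where
    w⋡z : ¬ InSubtree T r w z
    w⋡z w≽z = src≁dst _ _ m m (leafBranch-subtree (src-leaf m) root w≽z (dst-light m))
  ... | s , t , inj₁ (st , ¬rem) , w⋡s , w≽t , _ with edge-entering-subtree par w≽t w⋡s st
  ...   | refl , refl = ¬rem (_ , m , w , v , root , par , inj₂ (refl , refl))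
  M-edge-bridge m p avoids | v , w , root , par | s , t , inj₂ (inj₁ m′) , _ , w≽t , _ =
    src≁dst _ _ m m′ (leafBranch-subtree (src-leaf m) root w≽t (dst-light m′))
  M-edge-bridge m p avoids | v , w , root , par | s , t , inj₂ (inj₂ m′) , _ , w≽t , not-zu
    with src-unique _ _ m m′ (leafBranch-subtree (src-leaf m) root w≽t (src-light m′))
  ... | refl = not-zu (refl , refl)

  ¬M-closesCycle : ∀ {a b} → MEdge a b → ¬ Wᴹ.ClosesCycle a b
  ¬M-closesCycle (inj₁ m) (_ , p , u , 2≤p) = M-edge-bridge m p (Wᴹ.path-avoidsStep p u 2≤p)
  ¬M-closesCycle (inj₂ m) (_ , p , u , 2≤p) =
    M-edge-bridge m (Wᴹ.reverse Eᴹ-sym p) (Wᴹ.avoidsStep-reverse Eᴹ-sym p (Wᴹ.path-avoidsStep p u 2≤p))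

  tree-walk⊎M-step : ∀ {x y} (p : Walk Eᴹ x y) →
    (Σ (Walk E x y) λ q → verts q ≡ verts p) ⊎
    (Σ (Fin n) λ c → Σ (Fin n) λ d → Σ (Walk Eᴹ x c) λ p₁ → Σ (MEdge c d) λ m →
       Σ (Walk Eᴹ d y) λ p₂ → p ≡ p₁ Wᴹ.++ʷ step (inj₂ m) p₂)
  tree-walk⊎M-step stop = inj₁ (stop , refl)
  tree-walk⊎M-step (step (inj₂ m) p) = inj₂ (_ , _ , stop , m , p , refl)
  tree-walk⊎M-step (step (inj₁ (e , ¬rem)) p) with tree-walk⊎M-step p
  ... | inj₁ (q , eq)                    = inj₁ (step e q , cong (_ ∷_) eq)
  ... | inj₂ (c , d , p₁ , m , p₂ , refl) = inj₂ (c , d , step (inj₁ (e , ¬rem)) p₁ , m , p₂ , refl)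

  Eᴹ-acyclic : ¬ HasCycle Eᴹ
  Eᴹ-acyclic cycle with Wᴹ.hasCycle⇒closesCycle cycle
  ... | a , b , ab , p , u , 2≤p with tree-walk⊎M-step p
  ...   | inj₂ (c , d , p₁ , m , p₂ , refl) =
          ¬M-closesCycle m (Wᴹ.closesCycle-rotate ab p₁ (inj₂ m) p₂ u 2≤p)
  ...   | inj₁ (q , eq) with ab
  ...     | inj₂ m        = ¬M-closesCycle m (ab , p , u , 2≤p)
  ...     | inj₁ (abᵀ , _) = E-acyclic (closesCycle⇒hasCycle (abᵀ , q , subst Unique (sym eq) u , subst (2 ≤_) (sym wlen≡) 2≤p))
    where
    open ≡-Reasoning
    wlen≡ : wlen q ≡ wlen p
    wlen≡ = suc-injective (begin
      suc (wlen q)      ≡⟨ sym (length-verts q) ⟩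
      length (verts q)  ≡⟨ cong length eq ⟩
      length (verts p)  ≡⟨ Wᴹ.length-verts p ⟩
      suc (wlen p)      ∎)

  valid : Valid γ T r M
  valid = (λ _ _ → Eᴹ-sym) , Eᴹ-irrefl , Eᴹ-connected , Eᴹ-acyclic

  open Neighbours T

  Eᴹ-neighbour : ∀ {v t} → Eᴹ v t → t ∈ neighbours v ++ mNeighbours v M
  Eᴹ-neighbour (inj₁ (vt , _))  = ∈-++⁺ˡ (∈-neighbours⁺ vt)
  Eᴹ-neighbour (inj₂ (inj₁ m)) = ∈-++⁺ʳ _ (∈-mNeighbours-src m)
  Eᴹ-neighbour (inj₂ (inj₂ m)) = ∈-++⁺ʳ _ (∈-mNeighbours-dst m)

  Eᴹ-degree≤ : ∀ v ws → Unique ws → All (Eᴹ v) ws → length ws ≤ deg T v + dM M v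
  Eᴹ-degree≤ v ws u A = begin
    length ws                                         ≤⟨ Unique∧⊆⇒length≤ u (Eᴹ-neighbour ∘ All.lookup A) ⟩
    length (neighbours v ++ mNeighbours v M)          ≡⟨ length-++ (neighbours v) ⟩
    length (neighbours v) + length (mNeighbours v M)  ≡⟨ cong₂ _+_ (sym (deg≡length-neighbours v))
                                                                    (length-mNeighbours v M) ⟩
    deg T v + dM M v                                  ∎
    where open ≤-Reasoning

  Incident : Fin n → Set
  Incident v = Σ (OEdge n) λ e → e ∈ M × (v ≡ src e ⊎ v ≡ dst e)

  grown-degree≤ : ∀ {γ₀ q} → (∀ {e} → e ∈ M → deg T (src e) < γ₀ × deg T (dst e) < γ₀) →
                  (∀ v → Incident v → dM M v ≤ q) →
                  ∀ v → DegGe Eᴹ v (suc (deg T v)) → DegLe Eᴹ v (γ₀ + q)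
  grown-degree≤ {γ₀} {q} endpoint<γ₀ dM≤q v (ws , u , A , deg<ws) with dM M v in dM≡
  ... | zero  = ⊥-elim (<⇒≱ deg<ws (begin
        length ws          ≤⟨ Eᴹ-degree≤ v ws u A ⟩
        deg T v + dM M v   ≡⟨ cong (deg T v +_) dM≡ ⟩
        deg T v + 0        ≡⟨ +-identityʳ (deg T v) ⟩
        deg T v            ∎))
    where open ≤-Reasoning
  ... | suc _ = λ ws′ u′ A′ →
        ≤-trans (Eᴹ-degree≤ v ws′ u′ A′) (+-mono-≤ (<⇒≤ (endpoint-deg inc)) (dM≤q v inc))
    where
    inc = incident-of-dM≢0 dM≡
    endpoint-deg : Incident v → deg T v < γ₀
    endpoint-deg (_ , m , inj₁ refl) = proj₁ (endpoint<γ₀ m)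
    endpoint-deg (_ , m , inj₂ refl) = proj₂ (endpoint<γ₀ m)

  BelowOf : Fin n → OEdge n → Set
  BelowOf v e = e ∈ M × BranchParent γ T r (src e) v

  record NeighbourSplit (v : Fin n) (L : List (Fin n)) : Set where
    field
      keptNbrs        : List (Fin n)
      cutEdges        : List (OEdge n)
      keptNbrs-Unique : Unique keptNbrs
      keptNbrs-⊆      : keptNbrs ⊆ L
      keptNbrs-Eᴹ     : All (Eᴹ v) keptNbrs
      cutEdges-Unique : Unique cutEdges
      cutEdges-below  : All (BelowOf v) cutEdges
      cutEdges-source : All (λ e → Σ (Fin n) λ y → y ∈ L × src e ∼ y) cutEdges
      length-split    : length L ≤ length keptNbrs + length cutEdges

  neighbourSplit : ∀ {v} → Heavy v → ∀ L → Unique L → All (E v) L → NeighbourSplit v L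
  neighbourSplit hv [] _ _ = record
    { keptNbrs = [] ; cutEdges = [] ; keptNbrs-Unique = [] ; keptNbrs-⊆ = λ ()
    ; keptNbrs-Eᴹ = [] ; cutEdges-Unique = [] ; cutEdges-below = [] ; cutEdges-source = []
    ; length-split = z≤n }
  neighbourSplit {v} hv (y ∷ L) (y∉L ∷ uL) (vy ∷ AL) with cuts? v y
  ... | no ¬cut = record
    { keptNbrs        = y ∷ keptNbrs
    ; cutEdges        = cutEdges
    ; keptNbrs-Unique = All.tabulate (All.lookup y∉L ∘ keptNbrs-⊆) ∷ keptNbrs-Unique
    ; keptNbrs-⊆      = λ { (here refl) → here refl ; (there i) → there (keptNbrs-⊆ i) }
    ; keptNbrs-Eᴹ     = kept vy ¬cut ∷ keptNbrs-Eᴹ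
    ; cutEdges-Unique = cutEdges-Unique
    ; cutEdges-below  = cutEdges-below
    ; cutEdges-source = All.map (λ (y′ , i , s) → y′ , there i , s) cutEdges-source
    ; length-split    = s≤s length-split }
    where open NeighbourSplit (neighbourSplit hv L uL AL)
  ... | yes cut with find cut
  ...   | _ , _   , inj₁ (s , _ , _)   = ⊥-elim (light⇒¬heavy (∼-light₂ s) hv)
  ...   | e , e∈M , inj₂ (s , par , _) = record
    { keptNbrs        = keptNbrs
    ; cutEdges        = e ∷ cutEdges
    ; keptNbrs-Unique = keptNbrs-Unique
    ; keptNbrs-⊆      = there ∘ keptNbrs-⊆
    ; keptNbrs-Eᴹ     = keptNbrs-Eᴹ
    ; cutEdges-Unique = All.tabulate e≢ ∷ cutEdges-Unique
    ; cutEdges-below  = (e∈M , y , isBranchRoot-of-heavyParent s par hv , par) ∷ cutEdges-below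
    ; cutEdges-source = (y , here refl , s) ∷ All.map (λ (y′ , i , s) → y′ , there i , s) cutEdges-source
    ; length-split    = subst (suc (length L) ≤_) (sym (+-suc _ _)) (s≤s length-split) }
    where
    open NeighbourSplit (neighbourSplit hv L uL AL)
    e≢ : ∀ {e′} → e′ ∈ cutEdges → e ≢ e′
    e≢ i refl with All.lookup cutEdges-source i
    ... | y′ , y′∈L , s′ =
      All.lookup y∉L y′∈L (siblings-in-branch⇒≡ vy (All.lookup AL y′∈L) hv (∼-trans (∼-sym s) s′))

  improved-degree≥ : ∀ {q} → (∀ p es → Unique es → All (BelowOf p) es → length es ≤ q) →
                     ∀ v → Improved γ T r M v → DegGe Eᴹ v (γ ∸ q)
  improved-degree≥ {q} bundle≤q v (_ , _ , _ , w , root , par) =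
    keptNbrs , keptNbrs-Unique , keptNbrs-Eᴹ , m≤n+o⇒m∸n≤o γ q γ≤
    where
    hv = branchParent-heavy root par
    open NeighbourSplit (neighbourSplit hv (neighbours v) (neighbours-Unique v) (All.tabulate ∈-neighbours⁻))
    open ≤-Reasoning
    γ≤ : γ ≤ q + length keptNbrs
    γ≤ = begin
      γ                                    ≤⟨ hv ⟩
      deg T v                              ≡⟨ deg≡length-neighbours v ⟩
      length (neighbours v)                ≤⟨ length-split ⟩
      length keptNbrs + length cutEdges    ≤⟨ +-monoʳ-≤ (length keptNbrs)
                                                (bundle≤q v cutEdges cutEdges-Unique cutEdges-below) ⟩
      length keptNbrs + q                  ≡⟨ +-comm (length keptNbrs) q ⟩
      q + length keptNbrs                  ∎

mainTheorem5 : ∀ {n} (G T : Graph n) (r : Fin n) (d h γ γ₀ q : ℕ) (M : List (OEdge n)) →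
    SimpleGraph G → Connected (Edge G) → SpanningTree G T → MinMaxDeg G d →
    2 * d < h → γ₀ < γ → h ≤ γ₀ → 1 ≤ q →
    γ ≤ deg T r →
    Unique M → All (Good G γ γ₀ T r) M →
    (∀ e e′ → e ∈ M → e′ ∈ M → SameBranch γ T (src e) (src e′) → e ≡ e′) →
    (∀ e e′ → e ∈ M → e′ ∈ M → ¬ SameBranch γ T (src e) (dst e′)) →
    Valid γ T r M ×
    ((∀ v → (Σ (OEdge n) λ e → e ∈ M × (v ≡ src e ⊎ v ≡ dst e)) → dM M v ≤ q) →
     (∀ (p : Fin n) (es : List (OEdge n)) → Unique es →
        All (λ e → e ∈ M × BranchParent γ T r (src e) p) es → length es ≤ q) →
     Improvement γ T r M (γ ∸ q) (γ₀ + q))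
mainTheorem5 G T r d h γ γ₀ q M _ _ (_ , tree) _ _ _ _ _ r-heavy _ good src-unique src≁dst =
  valid , λ dM≤q bundle≤q → valid , improved-degree≥ bundle≤q , grown-degree≤ endpoint<γ₀ dM≤q
  where
  src-leaf : ∀ {e} → e ∈ M → LeafBranch γ T r (src e)
  src-leaf m with All.lookup good m
  ... | _ , leaf , _ = leaf
  dst-light : ∀ {e} → e ∈ M → deg T (dst e) < γ
  dst-light m with All.lookup good m
  ... | _ , _ , light , _ = light
  endpoint<γ₀ : ∀ {e} → e ∈ M → deg T (src e) < γ₀ × deg T (dst e) < γ₀
  endpoint<γ₀ m with All.lookup good m
  ... | _ , _ , _ , _ , bounds = bounds
  open Exchange T tree r γ r-heavy M src-leaf dst-light src-unique src≁dst
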